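{- For every integer $m\ge 3$, the equation $x_1+\dots+x_{m-1}=(m-1)^2x_m$ has degree of regularity exactly $2$. In particular, for every $m\ge 3$ there is a linear homogeneous equation in $m$ variables with degree of regularity $2$.
   Context: A linear equation $\mathcal{E}$ is $k$-regular if every coloring of the positive integers with $k$ colors admits a monochromatic solution to $\mathcal{E}$ in positive integers. The degree of regularity $dor(\mathcal{E})$ is the largest $k$ such that $\mathcal{E}$ is $k$-regular ($dor(\mathcal{E})=\infty$ if $\mathcal{E}$ is $k$-regular for all $k$). -}

module Defs where

open import Data.Nat using (ℕ; suc; _<_; _≤_; _∸_; _^_; _<ᵇ_)
open import Data.Bool using (if_then_else_)
open import Data.Fin using (Fin; toℕ)
open import Data.Integer as ℤ using (ℤ; +_; -_)
open import Data.Product using (Σ; _×_)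
open import Relation.Binary.PropositionalEquality using (_≡_)
open import Relation.Nullary using (¬_)

-- A homogeneous linear equation in m variables: coefficient vector a,
-- representing  a₀ x₀ + ... + a_{m-1} x_{m-1} = 0.
LinEq : ℕ → Set
LinEq m = Fin m → ℤ

sumℤ : ∀ {m} → (Fin m → ℤ) → ℤ
sumℤ {ℕ.zero} f = + 0
sumℤ {suc m} f = f Fin.zero ℤ.+ sumℤ (λ i → f (Fin.suc i))

IsSolution : ∀ {m} → LinEq m → (Fin m → ℕ) → Set
IsSolution a x = sumℤ (λ i → a i ℤ.* + (x i)) ≡ + 0

-- A k-coloring of the positive integers (the value at 0 is irrelevant).
Coloring : ℕ → Set
Coloring k = ℕ → Fin k

Regular : ∀ {m} → LinEq m → ℕ → Set
Regular {m} a k =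
  (c : Coloring k) →
  Σ (Fin m → ℕ) λ x →
    ((i : Fin m) → 1 ≤ x i) ×
    Σ (Fin k) (λ col → (i : Fin m) → c (x i) ≡ col) ×
    IsSolution a x

DegreeOfRegularity : ∀ {m} → LinEq m → ℕ → Set
DegreeOfRegularity a k = Regular a k × ((j : ℕ) → k < j → ¬ Regular a j)

-- x_1 + ... + x_{m-1} = (m-1)^2 x_m, i.e. coefficients
-- 1 for the first m-1 variables and -(m-1)^2 for the last one.
corEq : (m : ℕ) → LinEq m
corEq m i = if toℕ i <ᵇ (m ∸ 1) then + 1 else - (+ ((m ∸ 1) ^ 2))

-- Write n = m - 1 ≥ 2, so that the equation reads  x₁ + ... + x_n = n² y.
--
-- Two colours never suffice to avoid a monochromatic solution: a case split on
-- the colours of 1, n, n + 1, n(n-1) + 1, w = n²(n-1) + 1 and n w always lands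
-- on one of six explicit solutions, each using at most three distinct values.
--
-- Three colours do suffice: colour x by ⌊log_n x⌋ mod 3. If y has level L then
-- every xᵢ ≤ n² y < n^(L+3), so a level congruent to L mod 3 is at most L, i.e.
-- every xᵢ < n^(L+1); but then x₁ + ... + x_n < n^(L+2) ≤ n² y.
module Submission where

open import Defs
open import Data.Nat using (ℕ; zero; suc; _+_; _*_; _^_; _<_; _≤_; _<ᵇ_; z≤n; s≤s; z<s; _≤?_; _<?_; NonZero; >-nonZero⁻¹)
open import Data.Nat.Properties hiding (_≟_)
open import Data.Nat.Tactic.RingSolver using (solve-∀)
open import Data.Fin using (Fin; zero; suc; inject₁; fromℕ; inject≤; _≟_)
open import Data.Fin.Properties using (toℕ-inject₁; toℕ<n; toℕ-fromℕ; inject≤-injective)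
open import Data.Vec.Functional using (Vector; _∷_; replicate; head; tail; init; last)
open import Data.Integer as ℤ using (ℤ; +_; -_)
import Data.Integer.Properties as ℤ
open import Algebra.Properties.Monoid.Sum +-0-monoid using (sum; sum-cong-≗)
import Algebra.Properties.Monoid.Sum ℤ.+-0-monoid as ℤΣ
open import Data.Bool using (false)
open import Data.Bool.Properties using (T-≡)
open import Data.Product using (Σ; _×_; _,_)
open import Data.Sum using (inj₁; inj₂)
open import Data.Empty using (⊥-elim)
open import Function using (Equivalence; _∘_)
open import Relation.Nullary using (¬_; yes; no; contradiction)
open import Relation.Binary.PropositionalEquality

private
  variable
    A : Set
    d : ℕ

MonochromaticSolution : ∀ {m j} → LinEq m → Coloring j → Set
MonochromaticSolution {m} {j} a c =
  Σ (Fin m → ℕ) λ x →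
    ((i : Fin m) → 1 ≤ x i) ×
    Σ (Fin j) (λ col → (i : Fin m) → c (x i) ≡ col) ×
    IsSolution a x

_∷ʳ_ : Vector A d → A → Vector A (suc d)
_∷ʳ_ {d = zero}  xs y _       = y
_∷ʳ_ {d = suc d} xs y zero    = head xs
_∷ʳ_ {d = suc d} xs y (suc i) = (tail xs ∷ʳ y) i

init-∷ʳ : (xs : Vector A d) (y : A) → init (xs ∷ʳ y) ≗ xs
init-∷ʳ {d = suc d} xs y zero    = refl
init-∷ʳ {d = suc d} xs y (suc i) = init-∷ʳ (tail xs) y i

last-∷ʳ : (xs : Vector A d) (y : A) → last (xs ∷ʳ y) ≡ y
last-∷ʳ {d = zero}  xs y = refl
last-∷ʳ {d = suc d} xs y = last-∷ʳ (tail xs) y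

∷ʳ-all : (P : A → Set) {xs : Vector A d} {y : A} →
         (∀ i → P (xs i)) → P y → ∀ i → P ((xs ∷ʳ y) i)
∷ʳ-all {d = zero}  P pxs py _       = py
∷ʳ-all {d = suc d} P pxs py zero    = pxs zero
∷ʳ-all {d = suc d} P pxs py (suc i) = ∷ʳ-all P (pxs ∘ suc) py i

sum-replicate : ∀ k (t : ℕ) → sum (replicate k t) ≡ k * t
sum-replicate zero    t = refl
sum-replicate (suc k) t = cong (λ u → t + u) (sum-replicate k t)

xs≤sum : (xs : Vector ℕ d) (i : Fin d) → xs i ≤ sum xs
xs≤sum xs zero    = m≤m+n (xs zero) _
xs≤sum xs (suc i) = ≤-trans (xs≤sum (tail xs) i) (m≤n+m _ (xs zero))

sum≤* : ∀ {B} (xs : Vector ℕ d) → (∀ i → xs i ≤ B) → sum xs ≤ d * B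
sum≤* {zero}  xs _  = z≤n
sum≤* {suc d} xs xs≤B = +-mono-≤ (xs≤B zero) (sum≤* (tail xs) (λ i → xs≤B (suc i)))

sum<* : ∀ {B} (xs : Vector ℕ (suc d)) → (∀ i → xs i < B) → sum xs < suc d * B
sum<* xs xs<B = +-mono-<-≤ (xs<B zero) (sum≤* (tail xs) (λ i → <⇒≤ (xs<B (suc i))))

sumℤ≡sum : (f : Vector ℤ d) → sumℤ f ≡ ℤΣ.sum f
sumℤ≡sum {zero}  f = refl
sumℤ≡sum {suc d} f = cong (λ u → f zero ℤ.+ u) (sumℤ≡sum (tail f))

sum-pos : (f : Vector ℕ d) → ℤΣ.sum (+_ ∘ f) ≡ + sum f
sum-pos {zero}  f = refl
sum-pos {suc d} f = cong (λ u → + f zero ℤ.+ u) (sum-pos (tail f))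

n<ᵇn≡false : ∀ n → (n <ᵇ n) ≡ false
n<ᵇn≡false zero    = refl
n<ᵇn≡false (suc n) = n<ᵇn≡false n

corEq-init : ∀ {n} (i : Fin n) → corEq (suc n) (inject₁ i) ≡ + 1
corEq-init i rewrite toℕ-inject₁ i | Equivalence.to T-≡ (<⇒<ᵇ (toℕ<n i)) = refl

corEq-last : ∀ n → corEq (suc n) (fromℕ n) ≡ - + (n ^ 2)
corEq-last n rewrite toℕ-fromℕ n | n<ᵇn≡false n = refl

corEq-lhs : ∀ {n} (x : Vector ℕ (suc n)) →
            sumℤ (λ i → corEq (suc n) i ℤ.* + x i) ≡ + sum (init x) ℤ.- + (n ^ 2 * last x)
corEq-lhs {n} x = begin
  sumℤ a·x                             ≡⟨ sumℤ≡sum a·x ⟩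
  ℤΣ.sum a·x                           ≡⟨ ℤΣ.sum-init-last a·x ⟩
  ℤΣ.sum (init a·x) ℤ.+ last a·x       ≡⟨ cong₂ ℤ._+_ init-part last-part ⟩
  + sum (init x) ℤ.- + (n ^ 2 * last x) ∎
  where
  open ≡-Reasoning
  a·x : Vector ℤ (suc n)
  a·x i = corEq (suc n) i ℤ.* + x i
  init-part : ℤΣ.sum (init a·x) ≡ + sum (init x)
  init-part = trans (ℤΣ.sum-cong-≗ (λ i → trans (cong (λ a → a ℤ.* + init x i) (corEq-init i)) (ℤ.*-identityˡ _)))
                    (sum-pos (init x))
  last-part : last a·x ≡ - + (n ^ 2 * last x)
  last-part = begin
    corEq (suc n) (fromℕ n) ℤ.* + last x ≡⟨ cong (λ a → a ℤ.* + last x) (corEq-last n) ⟩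
    - + (n ^ 2) ℤ.* + last x            ≡⟨ ℤ.neg-distribˡ-* (+ (n ^ 2)) (+ last x) ⟨
    - (+ (n ^ 2) ℤ.* + last x)          ≡⟨ cong -_ (ℤ.pos-* (n ^ 2) (last x)) ⟨
    - + (n ^ 2 * last x)                ∎

isSolution⇒ : ∀ {n} (x : Vector ℕ (suc n)) →
              IsSolution (corEq (suc n)) x → sum (init x) ≡ n ^ 2 * last x
isSolution⇒ x sol = ℤ.+-injective (ℤ.i-j≡0⇒i≡j _ _ (trans (sym (corEq-lhs x)) sol))

⇒isSolution : ∀ {n} (x : Vector ℕ (suc n)) →
              sum (init x) ≡ n ^ 2 * last x → IsSolution (corEq (suc n)) x
⇒isSolution x eq = trans (corEq-lhs x) (ℤ.i≡j⇒i-j≡0 (cong +_ eq))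

corEq-solution : ∀ k {j} (c : Coloring j) (s t y : ℕ)
                 .{{_ : NonZero s}} .{{_ : NonZero t}} .{{_ : NonZero y}} →
                 c s ≡ c y → c t ≡ c y → s + k * t ≡ suc k * suc k * y →
                 MonochromaticSolution (corEq (2 + k)) c
corEq-solution k c s t y cs≡cy ct≡cy eq =
  x , ∷ʳ-all (1 ≤_) (s∷t (>-nonZero⁻¹ s) (>-nonZero⁻¹ t)) (>-nonZero⁻¹ y) ,
  (c y , ∷ʳ-all (λ v → c v ≡ c y) (s∷t cs≡cy ct≡cy) refl) ,
  ⇒isSolution x (begin
    sum (init x)               ≡⟨ sum-cong-≗ (init-∷ʳ (s ∷ replicate k t) y) ⟩
    s + sum (replicate k t)    ≡⟨ cong (λ u → s + u) (sum-replicate k t) ⟩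
    s + k * t                  ≡⟨ eq ⟩
    suc k * suc k * y          ≡⟨ cong (λ a → suc k * a * y) (^-identityʳ (suc k)) ⟨
    suc k ^ 2 * y              ≡⟨ cong (suc k ^ 2 *_) (last-∷ʳ (s ∷ replicate k t) y) ⟨
    suc k ^ 2 * last x         ∎)
  where
  open ≡-Reasoning
  x : Vector ℕ (2 + k)
  x = (s ∷ replicate k t) ∷ʳ y
  s∷t : ∀ {P : ℕ → Set} → P s → P t → ∀ i → P ((s ∷ replicate k t) i)
  s∷t ps pt zero    = ps
  s∷t ps pt (suc _) = pt

≢∧≢⇒≡ : {a b c : Fin 2} → a ≢ c → b ≢ c → a ≡ b
≢∧≢⇒≡ {zero}     {zero}                 _   _   = refl
≢∧≢⇒≡ {suc zero} {suc zero}             _   _   = refl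
≢∧≢⇒≡ {zero}     {suc zero} {zero}      a≢c _   = ⊥-elim (a≢c refl)
≢∧≢⇒≡ {zero}     {suc zero} {suc zero}  _   b≢c = ⊥-elim (b≢c refl)
≢∧≢⇒≡ {suc zero} {zero}     {zero}      _   b≢c = ⊥-elim (b≢c refl)
≢∧≢⇒≡ {suc zero} {zero}     {suc zero}  a≢c _   = ⊥-elim (a≢c refl)

-- The equations of the six solutions used below, with n, z and w unfolded so
-- that the ring solver can see them.
solves-n-n-1 : ∀ k → (1 + k) + k * (1 + k) ≡ (1 + k) * (1 + k) * 1
solves-n-n-1 = solve-∀
solves-1-n+1-1 : ∀ k → 1 + k * (2 + k) ≡ (1 + k) * (1 + k) * 1
solves-1-n+1-1 = solve-∀
solves-z-1-1 : ∀ k → (1 + (1 + k) * k) + k * 1 ≡ (1 + k) * (1 + k) * 1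
solves-z-1-1 = solve-∀
solves-w-n+1-n : ∀ k → (1 + (1 + k) * (1 + k) * k) + k * (2 + k) ≡ (1 + k) * (1 + k) * (1 + k)
solves-w-n+1-n = solve-∀
solves-nw-nw-w : ∀ k w → (1 + k) * w + k * ((1 + k) * w) ≡ (1 + k) * (1 + k) * w
solves-nw-nw-w = solve-∀
solves-nw-n-z : ∀ k → (1 + k) * (1 + (1 + k) * (1 + k) * k) + k * (1 + k)
                      ≡ (1 + k) * (1 + k) * (1 + (1 + k) * k)
solves-nw-n-z = solve-∀

module _ (k : ℕ) (c : Coloring 2) where
  private
    n z w : ℕ
    n = 1 + k
    z = 1 + n * k
    w = 1 + n * n * k

    solution : ∀ s t y .{{_ : NonZero s}} .{{_ : NonZero t}} .{{_ : NonZero y}} →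
               c s ≡ c y → c t ≡ c y → s + k * t ≡ n * n * y →
               MonochromaticSolution (corEq (2 + k)) c
    solution = corEq-solution k c

  corEq-2-regular : MonochromaticSolution (corEq (2 + k)) c
  corEq-2-regular with c n ≟ c 1 | c (1 + n) ≟ c 1 | c z ≟ c 1
  ... | yes n~1 | _        | _      = solution n n 1 n~1 n~1 (solves-n-n-1 k)
  ... | no _    | yes n+1~1 | _     = solution 1 (1 + n) 1 refl n+1~1 (solves-1-n+1-1 k)
  ... | no _    | no _     | yes z~1 = solution z 1 1 z~1 refl (solves-z-1-1 k)
  ... | no n≁1  | no n+1≁1 | no z≁1 with c w ≟ c n
  ...   | yes w~n = solution w (1 + n) n w~n (≢∧≢⇒≡ n+1≁1 n≁1) (solves-w-n+1-n k)
  ...   | no w≁n with c (n * w) ≟ c w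
  ...     | yes nw~w = solution (n * w) (n * w) w nw~w nw~w (solves-nw-nw-w k w)
  ...     | no nw≁w  = solution (n * w) n z (≢∧≢⇒≡ nw≁1 z≁1) (≢∧≢⇒≡ n≁1 z≁1) (solves-nw-n-z k)
    where
    nw≁1 : c (n * w) ≢ c 1
    nw≁1 nw~1 = nw≁w (trans nw~1 (sym (≢∧≢⇒≡ w≁n (n≁1 ∘ sym))))

logSearch : (b fuel e x : ℕ) → ℕ
logSearch b zero       e x = e
logSearch b (suc fuel) e x with b ^ suc e ≤? x
... | yes _ = logSearch b fuel (suc e) x
... | no  _ = e

-- The fuel x suffices because x < b ^ (1 + x) for b ≥ 2; junk value 0 at x = 0.
⌊log_⌋_ : ℕ → ℕ → ℕ
⌊log b ⌋ x = logSearch b x 0 x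

^logSearch≤ : ∀ b fuel e x → b ^ e ≤ x → b ^ logSearch b fuel e x ≤ x
^logSearch≤ b zero       e x b^e≤x = b^e≤x
^logSearch≤ b (suc fuel) e x b^e≤x with b ^ suc e ≤? x
... | yes b^1+e≤x = ^logSearch≤ b fuel (suc e) x b^1+e≤x
... | no  _       = b^e≤x

<^suc-logSearch : ∀ b fuel e x → x < b ^ suc (e + fuel) → x < b ^ suc (logSearch b fuel e x)
<^suc-logSearch b zero       e x x<b^1+e rewrite +-identityʳ e = x<b^1+e
<^suc-logSearch b (suc fuel) e x x<b^1+e+f with b ^ suc e ≤? x
... | yes _     = <^suc-logSearch b fuel (suc e) x (subst (λ d → x < b ^ suc d) (+-suc e fuel) x<b^1+e+f)
... | no  b^1+e≰x = ≰⇒> b^1+e≰x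

n<b^n : ∀ {b} → 2 ≤ b → ∀ n → n < b ^ n
n<b^n {b@(suc _)} 2≤b zero    = z<s
n<b^n {b@(suc _)} 2≤b (suc n) = begin-strict
  suc n            <⟨ +-mono-≤ (m^n>0 b n) (≤-trans (n<b^n 2≤b n) (m≤m+n _ 0)) ⟩
  2 * b ^ n        ≤⟨ *-monoˡ-≤ (b ^ n) 2≤b ⟩
  b * b ^ n        ∎
  where open ≤-Reasoning

^⌊log⌋≤ : ∀ b {x} → 1 ≤ x → b ^ (⌊log b ⌋ x) ≤ x
^⌊log⌋≤ b {x} = ^logSearch≤ b x 0 x

<^suc⌊log⌋ : ∀ {b} → 2 ≤ b → ∀ x → x < b ^ suc (⌊log b ⌋ x)
<^suc⌊log⌋ {b} 2≤b x = <^suc-logSearch b x 0 x (<-trans (n<b^n 2≤b x) (^-monoʳ-< b 2≤b (n<1+n x)))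

m^n<m^o⇒n<o : ∀ m .{{_ : NonZero m}} {n o} → m ^ n < m ^ o → n < o
m^n<m^o⇒n<o m {n} {o} m^n<m^o with n <? o
... | yes n<o = n<o
... | no  n≮o = contradiction (^-monoʳ-≤ m (≮⇒≥ n≮o)) (<⇒≱ m^n<m^o)

mod3 : ℕ → Fin 3
mod3 0                   = zero
mod3 1                   = suc zero
mod3 2                   = suc (suc zero)
mod3 (suc (suc (suc a))) = mod3 a

mod3-1+a≢mod3-a : ∀ a → mod3 (1 + a) ≢ mod3 a
mod3-1+a≢mod3-a 0                   ()
mod3-1+a≢mod3-a 1                   ()
mod3-1+a≢mod3-a 2                   ()
mod3-1+a≢mod3-a (suc (suc (suc a))) = mod3-1+a≢mod3-a a

mod3-2+a≢mod3-a : ∀ a → mod3 (2 + a) ≢ mod3 a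
mod3-2+a≢mod3-a 0                   ()
mod3-2+a≢mod3-a 1                   ()
mod3-2+a≢mod3-a 2                   ()
mod3-2+a≢mod3-a (suc (suc (suc a))) = mod3-2+a≢mod3-a a

mod3-≡∧<3+⇒≤ : ∀ {a b} → mod3 a ≡ mod3 b → a < 3 + b → a ≤ b
mod3-≡∧<3+⇒≤ {a} {b} a≡b (s≤s a≤2+b) with m≤n⇒m<n∨m≡n a≤2+b
... | inj₂ refl = contradiction a≡b (mod3-2+a≢mod3-a b)
... | inj₁ (s≤s a≤1+b) with m≤n⇒m<n∨m≡n a≤1+b
...   | inj₂ refl       = contradiction a≡b (mod3-1+a≢mod3-a b)
...   | inj₁ (s≤s a≤b) = a≤b

logColouring : ∀ b {j} → 3 ≤ j → Coloring j
logColouring b 3≤j x = inject≤ (mod3 (⌊log b ⌋ x)) 3≤j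

sum-init≢b²*last : ∀ k (x : Vector ℕ (3 + k)) → (∀ i → 1 ≤ x i) →
                   (∀ i → mod3 (⌊log (2 + k) ⌋ (x i)) ≡ mod3 (⌊log (2 + k) ⌋ (last x))) →
                   sum (init x) ≢ (2 + k) ^ 2 * last x
sum-init≢b²*last k x positive sameClass sum≡ = <-irrefl sum≡ sum<
  where
  open ≤-Reasoning
  b = 2 + k
  y = last x
  L = ⌊log b ⌋ y
  2≤b : 2 ≤ b
  2≤b = s≤s (s≤s z≤n)

  sum<b^3+L : sum (init x) < b ^ (3 + L)
  sum<b^3+L = begin-strict
    sum (init x)      ≡⟨ sum≡ ⟩
    b ^ 2 * y         <⟨ *-monoʳ-< (b ^ 2) (<^suc⌊log⌋ 2≤b y) ⟩
    b ^ 2 * b ^ suc L ≡⟨ ^-distribˡ-+-* b 2 (suc L) ⟨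
    b ^ (3 + L)       ∎

  ⌊log⌋-init≤L : ∀ i → ⌊log b ⌋ (init x i) ≤ L
  ⌊log⌋-init≤L i = mod3-≡∧<3+⇒≤ (sameClass (inject₁ i)) (m^n<m^o⇒n<o b (begin-strict
    b ^ (⌊log b ⌋ (init x i)) ≤⟨ ^⌊log⌋≤ b (positive (inject₁ i)) ⟩
    init x i                  ≤⟨ xs≤sum (init x) i ⟩
    sum (init x)              <⟨ sum<b^3+L ⟩
    b ^ (3 + L)               ∎))

  init<b^1+L : ∀ i → init x i < b ^ suc L
  init<b^1+L i = <-≤-trans (<^suc⌊log⌋ 2≤b (init x i)) (^-monoʳ-≤ b (s≤s (⌊log⌋-init≤L i)))

  sum< : sum (init x) < b ^ 2 * y
  sum< = begin-strict
    sum (init x)  <⟨ sum<* (init x) init<b^1+L ⟩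
    b * b ^ suc L ≡⟨ ^-distribˡ-+-* b 2 L ⟩
    b ^ 2 * b ^ L ≤⟨ *-monoʳ-≤ (b ^ 2) (^⌊log⌋≤ b (positive (fromℕ _))) ⟩
    b ^ 2 * y     ∎

corEq-not-regular : ∀ k j → 2 < j → ¬ Regular (corEq (3 + k)) j
corEq-not-regular k j 3≤j regular with regular (logColouring (2 + k) 3≤j)
... | x , positive , (_ , monochromatic) , sol =
  sum-init≢b²*last k x positive sameClass (isSolution⇒ x sol)
  where
  sameClass : ∀ i → mod3 (⌊log (2 + k) ⌋ (x i)) ≡ mod3 (⌊log (2 + k) ⌋ (last x))
  sameClass i = inject≤-injective 3≤j 3≤j _ _ (trans (monochromatic i) (sym (monochromatic (fromℕ _))))

corollary2 : (m : ℕ) → 3 ≤ m → DegreeOfRegularity (corEq m) 2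
corollary2 (suc (suc (suc k))) (s≤s (s≤s (s≤s z≤n))) =
  corEq-2-regular (suc k) , corEq-not-regular k
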